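{- Consider any execution of a finite parallel composition of the simplified find-or-put procedure $\mathrm{Fop}$ (described in the context) on a table $T$, with no other process accessing $T$. Then no step of $\mathrm{Fop}$ modifies a nonempty slot of $T$. Consequently, the following is an invariant of every process executing $\mathrm{Fop}(k)$: for all $(x,y)\in S$, if $b_x[y]\neq\mathrm{EMPTY}$ then $b_x[y]=T_{\operatorname{sg}(x)}[a_x(k)][y]$.
   Context: Let $K$ be a set of keys and fix positive integers $B_0,B_1$. A table $T=(T_0,T_1)$ consists of a primary array $T_0$ of buckets, each with $B_0$ slots $T_0[c][0..B_0-1]$, and a secondary array $T_1$ of buckets, each with $B_1$ slots $T_1[c][0..B_1-1]$. Each slot holds a distinguished value $\mathrm{EMPTY}$ or another value. Given are address functions $a_0$ (into bucket indices of $T_0$), $a_1,a_2$ (into bucket indices of $T_1$), and remainder functions $r_0,r_1,r_2$ on $K$ with values different from $\mathrm{EMPTY}$. Put $r'_0(k)=r_0(k)$, $r'_1(k)=(r_1(k),0)$, $r'_2(k)=(r_2(k),1)$, $\operatorname{sg}(0)=0$, $\operatorname{sg}(1)=\operatorname{sg}(2)=1$, and $S=\{0\}\times\{0,\dots,B_0-1\}\cup\{1,2\}\times\{0,\dots,B_1-1\}$. The total order $\prec$ on $S$: $(0,y)\prec(1+i,z)$ for all $y,z$, $i\in\{0,1\}$; $(x,y)\prec(x,z)$ iff $y<z$; $(1,y)\prec(2,z)$ iff $y<z$ (equivalently $(2,z)\prec(1,y)$ iff $z\le y$). Simplified find-or-put $\mathrm{Fop}(k)$, with local snapshot arrays $b_0,b_1,b_2$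 (initially all $\mathrm{EMPTY}$): repeat forever: (1) for $x=0,1,2$ copy bucket $T_{\operatorname{sg}(x)}[a_x(k)]$ into $b_x$ slot by slot; (2) if $b_x[y]=r'_x(k)$ for some $(x,y)\in S$, return $\mathrm{FOUND}$; (3) else if $b_x[y]\ne\mathrm{EMPTY}$ for all $(x,y)\in S$, return $\mathrm{FULL}$; (4) else let $(x,y)$ be the $\prec$-minimum of $\{(x,y)\in S: b_x[y]=\mathrm{EMPTY}\}$ and execute $\mathrm{CAS}(T_{\operatorname{sg}(x)}[a_x(k)][y],\mathrm{EMPTY},r'_x(k))$; if it succeeds, return $\mathrm{PUT}$. Here $\mathrm{CAS}(s,\mathrm{EMPTY},v)$ atomically checks whether slot $s$ equals $\mathrm{EMPTY}$ and if so writes $v$ and returns true, otherwise returns false. Execution model: finitely many processes run $\mathrm{Fop}$ concurrently with their own local variables, sharing only $T$; executions are arbitrary interleavings of atomic steps, the only atomic operations on $T$ being single-slot reads and CAS. An invariant is a property holding in every state of every such execution. -}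

module Defs where

open import Data.Nat using (ℕ; zero; suc)
open import Data.Fin using (Fin; zero; suc) renaming (_<_ to _<ᶠ_; _≤_ to _≤ᶠ_)
open import Data.Maybe using (Maybe; just; nothing)
import Data.Maybe as Maybe
open import Data.Product using (Σ; _×_; _,_; ∃)
open import Relation.Binary.PropositionalEquality using (_≡_; _≢_)
open import Relation.Nullary using (¬_)
open import Data.Sum using (_⊎_)

record Setup : Set₁ where
  field
    K  : Set
    R0 : Set
    R1 : Set
    N0 : ℕ
    N1 : ℕ
    b0 : ℕ            -- B0 = suc b0
    b1 : ℕ            -- B1 = suc b1
    a0 : K → Fin N0
    a1 : K → Fin N1
    a2 : K → Fin N1
    r0 : K → R0
    r1 : K → R1
    r2 : K → R1

finNext : ∀ {n} → Fin n → Maybe (Fin n)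
finNext {suc zero} zero = nothing
finNext {suc (suc n)} zero = just (suc zero)
finNext {suc (suc n)} (suc i) = Maybe.map suc (finNext i)

sg : Fin 3 → Fin 2
sg zero = zero
sg (suc _) = suc zero

data Result : Set where
  FOUND FULL PUT : Result

module Model (P : Setup) where
  open Setup P

  B0 B1 : ℕ
  B0 = suc b0
  B1 = suc b1

  Bsz : Fin 2 → ℕ
  Bsz zero = B0
  Bsz (suc _) = B1

  Nb : Fin 2 → ℕ
  Nb zero = N0
  Nb (suc _) = N1

  V : Fin 2 → Set
  V zero = Maybe R0
  V (suc _) = Maybe (R1 × Fin 2)

  EMPTY : (t : Fin 2) → V t
  EMPTY zero = nothing
  EMPTY (suc _) = nothing

  -- T = (T0 , T1):  T t c y  is slot y of bucket c of T_t
  Table : Set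
  Table = (t : Fin 2) → Fin (Nb t) → Fin (Bsz t) → V t

  a : (x : Fin 3) → K → Fin (Nb (sg x))
  a zero = a0
  a (suc zero) = a1
  a (suc (suc zero)) = a2

  r' : (x : Fin 3) → K → V (sg x)
  r' zero k = just (r0 k)
  r' (suc zero) k = just (r1 k , zero)
  r' (suc (suc zero)) k = just (r2 k , suc zero)

  S : Set
  S = Σ (Fin 3) (λ x → Fin (Bsz (sg x)))

  data _≺_ : S → S → Set where
    ≺-01 : ∀ (y : Fin B0) (i : Fin 2) (z : Fin (Bsz (sg (suc i)))) →
           (zero , y) ≺ (suc i , z)
    ≺-same : ∀ (x : Fin 3) (y z : Fin (Bsz (sg x))) → y <ᶠ z → (x , y) ≺ (x , z)
    ≺-12 : ∀ (y z : Fin B1) → y <ᶠ z → (suc zero , y) ≺ (suc (suc zero) , z)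
    ≺-21 : ∀ (z y : Fin B1) → z ≤ᶠ y → (suc (suc zero) , z) ≺ (suc zero , y)

  Snap : Set
  Snap = (x : Fin 3) → Fin (Bsz (sg x)) → V (sg x)

  data PC : Set where
    read   : S → PC        -- about to read slot (x,y) of bucket T_{sg x}[a_x k] into b_x[y]
    decide : PC            -- snapshot complete; evaluate (2)-(4)
    cas    : S → PC        -- about to execute the CAS on the chosen slot
    done   : Result → PC

  firstSlot : S
  firstSlot = (zero , zero)

  afterRead : S → PC
  afterRead (x , y) with finNext y
  ... | just y' = read (x , y')
  afterRead (zero , y) | nothing = read (suc zero , zero)
  afterRead (suc zero , y) | nothing = read (suc (suc zero) , zero)
  afterRead (suc (suc zero) , y) | nothing = decide

  record Local : Set where
    constructor mkLocal
    field
      pc : PC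
      b  : Snap
  open Local public

  record State (n : ℕ) : Set where
    constructor mkState
    field
      T : Table
      L : Fin n → Local
  open State public

  Addr : Set
  Addr = Σ (Fin 2) (λ t → Fin (Nb t) × Fin (Bsz t))

  module _ {n : ℕ} (keys : Fin n → K) where

    FrameT : State n → State n → Set
    FrameT s s' = ∀ t c z → T s' t c z ≡ T s t c z

    FrameL : Fin n → State n → State n → Set
    FrameL i s s' = ∀ j → j ≢ i → L s' j ≡ L s j

    SameB : Fin n → State n → State n → Set
    SameB i s s' = ∀ x y → b (L s' i) x y ≡ b (L s i) x y

    Found : K → Snap → Set
    Found k bb = Σ S (λ { (x , y) → bb x y ≡ r' x k })

    AllNonempty : Snap → Set
    AllNonempty bb = ∀ x y → bb x y ≢ EMPTY (sg x)

    MinEmpty : Snap → S → Set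
    MinEmpty bb (x , y) =
      bb x y ≡ EMPTY (sg x) ×
      (∀ x' y' → bb x' y' ≡ EMPTY (sg x') → (x , y) ≡ (x' , y') ⊎ (x , y) ≺ (x' , y'))

    -- atomic steps of the composition; process i runs Fop (keys i)
    data Step (s s' : State n) : Set where
      stepRead : ∀ i x y →
        pc (L s i) ≡ read (x , y) →
        FrameT s s' → FrameL i s s' →
        pc (L s' i) ≡ afterRead (x , y) →
        b (L s' i) x y ≡ T s (sg x) (a x (keys i)) y →
        (∀ x' y' → (x , y) ≢ (x' , y') → b (L s' i) x' y' ≡ b (L s i) x' y') →
        Step s s'
      stepFound : ∀ i →
        pc (L s i) ≡ decide →
        Found (keys i) (b (L s i)) →
        FrameT s s' → FrameL i s s' → SameB i s s' →
        pc (L s' i) ≡ done FOUND →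
        Step s s'
      stepFull : ∀ i →
        pc (L s i) ≡ decide →
        ¬ Found (keys i) (b (L s i)) →
        AllNonempty (b (L s i)) →
        FrameT s s' → FrameL i s s' → SameB i s s' →
        pc (L s' i) ≡ done FULL →
        Step s s'
      stepChoose : ∀ i p →
        pc (L s i) ≡ decide →
        ¬ Found (keys i) (b (L s i)) →
        MinEmpty (b (L s i)) p →
        FrameT s s' → FrameL i s s' → SameB i s s' →
        pc (L s' i) ≡ cas p →
        Step s s'
      stepCasOk : ∀ i x y →
        pc (L s i) ≡ cas (x , y) →
        T s (sg x) (a x (keys i)) y ≡ EMPTY (sg x) →
        T s' (sg x) (a x (keys i)) y ≡ r' x (keys i) →
        (∀ t c z → _≢_ {A = Addr} (t , c , z) (sg x , a x (keys i) , y) →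
           T s' t c z ≡ T s t c z) →
        FrameL i s s' → SameB i s s' →
        pc (L s' i) ≡ done PUT →
        Step s s'
      stepCasFail : ∀ i x y →
        pc (L s i) ≡ cas (x , y) →
        T s (sg x) (a x (keys i)) y ≢ EMPTY (sg x) →
        FrameT s s' → FrameL i s s' → SameB i s s' →
        pc (L s' i) ≡ read firstSlot →
        Step s s'

    Init : State n → Set
    Init s = ∀ i → pc (L s i) ≡ read firstSlot × (∀ x y → b (L s i) x y ≡ EMPTY (sg x))

    data Reachable : State n → Set where
      init : ∀ {s} → Init s → Reachable s
      step : ∀ {s s'} → Reachable s → Step s s' → Reachable s'

{-# OPTIONS --safe #-}
module Submission where

-- The only step that writes to the table is a successful CAS, and it writes a
-- slot it has just found EMPTY; so a nonempty slot never changes.  A nonempty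
-- snapshot entry was copied from its slot while that slot was nonempty, hence
-- it keeps agreeing with the slot forever after.

open import Defs
open import Data.Nat using (ℕ)
open import Data.Fin using (Fin)
open import Data.Fin.Properties using (_≟_)
open import Data.Product using (_×_; _,_; proj₂)
open import Data.Product.Properties using (≡-dec)
open import Data.Sum using (_⊎_; inj₁; inj₂)
open import Data.Empty using (⊥-elim)
open import Relation.Binary.Definitions using (DecidableEquality)
open import Relation.Binary.PropositionalEquality using (_≡_; _≢_; refl; sym; trans; cong; subst)
open import Relation.Nullary using (yes; no)

module Invariant (P : Setup) {n : ℕ} (keys : Fin n → Setup.K P) where
  open Setup P
  open Model P

  _≟ᴬ_ : DecidableEquality Addr
  _≟ᴬ_ = ≡-dec _≟_ (≡-dec _≟_ _≟_)

  _≟ˢ_ : DecidableEquality S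
  _≟ˢ_ = ≡-dec _≟_ _≟_

  _⊑_ : Table → Table → Set
  T ⊑ T′ = ∀ t c z → T t c z ≢ EMPTY t → T′ t c z ≡ T t c z

  step-⊑ : ∀ {s s′} → Step keys s s′ → T s ⊑ T s′
  step-⊑ (stepRead _ _ _ _ ft _ _ _ _)    t c z _ = ft t c z
  step-⊑ (stepFound _ _ _ ft _ _ _)       t c z _ = ft t c z
  step-⊑ (stepFull _ _ _ _ ft _ _ _)      t c z _ = ft t c z
  step-⊑ (stepChoose _ _ _ _ _ ft _ _ _)  t c z _ = ft t c z
  step-⊑ (stepCasFail _ _ _ _ _ ft _ _ _) t c z _ = ft t c z
  step-⊑ (stepCasOk i x y _ empty _ others _ _ _) t c z nonempty
    with (t , c , z) ≟ᴬ (sg x , a x (keys i) , y)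
  ... | yes refl = ⊥-elim (nonempty empty)
  ... | no other = others t c z other

  Agrees : Table → K → (x : Fin 3) → Fin (Bsz (sg x)) → V (sg x) → Set
  Agrees T k x y v = v ≢ EMPTY (sg x) → v ≡ T (sg x) (a x k) y

  Agrees-⊑ : ∀ {T T′ k x y v} → T ⊑ T′ → Agrees T k x y v → Agrees T′ k x y v
  Agrees-⊑ T⊑T′ agrees nonempty =
    trans (agrees nonempty) (sym (T⊑T′ _ _ _ λ empty → nonempty (trans (agrees nonempty) empty)))

  Consistent : State n → Set
  Consistent s = ∀ i x y → Agrees (T s) (keys i) x y (b (L s i) x y)

  snapshots-framed : ∀ {s s′} i → FrameL keys i s s′ → SameB keys i s s′ →
                     ∀ j x y → b (L s′ j) x y ≡ b (L s j) x y
  snapshots-framed i frame same j x y with j ≟ i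
  ... | yes refl = same x y
  ... | no j≢i   = cong (λ l → b l x y) (frame j j≢i)

  snapshot-after-step : ∀ {s s′} → Step keys s s′ → ∀ j x y →
    b (L s′ j) x y ≡ b (L s j) x y ⊎ b (L s′ j) x y ≡ T s′ (sg x) (a x (keys j)) y
  snapshot-after-step (stepRead i x y _ ft frame _ copied others) j x′ y′ with j ≟ i
  ... | no j≢i = inj₁ (cong (λ l → b l x′ y′) (frame j j≢i))
  ... | yes refl with (x , y) ≟ˢ (x′ , y′)
  ...   | yes refl = inj₂ (trans copied (sym (ft _ _ _)))
  ...   | no other = inj₁ (others x′ y′ other)
  snapshot-after-step {s} {s′} (stepFound i _ _ _ frame same _) j x y =
    inj₁ (snapshots-framed {s} {s′} i frame same j x y)
  snapshot-after-step {s} {s′} (stepFull i _ _ _ _ frame same _) j x y =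
    inj₁ (snapshots-framed {s} {s′} i frame same j x y)
  snapshot-after-step {s} {s′} (stepChoose i _ _ _ _ _ frame same _) j x y =
    inj₁ (snapshots-framed {s} {s′} i frame same j x y)
  snapshot-after-step {s} {s′} (stepCasOk i _ _ _ _ _ _ frame same _) j x y =
    inj₁ (snapshots-framed {s} {s′} i frame same j x y)
  snapshot-after-step {s} {s′} (stepCasFail i _ _ _ _ _ frame same _) j x y =
    inj₁ (snapshots-framed {s} {s′} i frame same j x y)

  step-Consistent : ∀ {s s′} → Step keys s s′ → Consistent s → Consistent s′
  step-Consistent {s} {s′} st consistent j x y with snapshot-after-step st j x y
  ... | inj₁ unchanged = subst (Agrees (T s′) (keys j) x y) (sym unchanged)
                               (Agrees-⊑ (step-⊑ st) (consistent j x y))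
  ... | inj₂ copied    = λ _ → copied

  reachable-Consistent : ∀ {s} → Reachable keys s → Consistent s
  reachable-Consistent (init initial) i x y nonempty = ⊥-elim (nonempty (proj₂ (initial i) x y))
  reachable-Consistent (step r st) = step-Consistent st (reachable-Consistent r)

lemma2 : (P : Setup) → (n : ℕ) → (keys : Fin n → Setup.K P) →
    let open Model P in
    (∀ s s' → Reachable keys s → Step keys s s' →
       ∀ t c z → T s t c z ≢ EMPTY t → T s' t c z ≡ T s t c z)
    ×
    (∀ s → Reachable keys s → ∀ i x y →
       b (L s i) x y ≢ EMPTY (sg x) →
       b (L s i) x y ≡ T s (sg x) (a x (keys i)) y)
lemma2 P n keys = (λ _ _ _ → step-⊑) , λ _ → reachable-Consistent
  where open Invariant P keys
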